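{- Let $\vec U$ be a distributive submodular universe. For every profile $P$ in $\vec U$ and every set $\mathcal P'$ of strongly robust profiles in $\vec U$ each of which is distinguishable from $P$, there exists a nested set $N$ of separations which distinguishes $P$ efficiently from every profile in $\mathcal P'$.
   Context: A separation system is a finite poset with an order-reversing involution ${}^*$; write $\overleftarrow s:=\vec s^{\,*}$, $s:=\{\vec s,\overleftarrow s\}$. $r,s$ are nested if some orientations satisfy $\vec r\le\vec s$; a set is nested if pairwise nested. A universe $\vec U$ is a separation system whose poset is a lattice ($\vee,\wedge$); distributive if $\vec a\vee(\vec b\wedge\vec c)=(\vec a\vee\vec b)\wedge(\vec a\vee\vec c)$ always; submodular if it carries $|\cdot|:\vec U\to\mathbb N_0$ with $|\vec a|=|\overleftarrow a|=:|a|$ and $|\vec a|+|\vec b|\ge|\vec a\vee\vec b|+|\vec a\wedge\vec b|$. $\vec S_k:=\{\vec a\in\vec U:|\vec a|<k\}$. A profile in $\vec U$ (a $k$-profile for some $k$) is a consistent orientation $P$ of $S_k$ (exactly one orientation of each element, no $\vec a,\vec b$ with $a\ne b$, $\overleftarrow a\le\vec b$) with $\overleftarrow a\wedge\overleftarrow b\notin P$ for all $\vec a,\vec b\in P$. A $k$-profile is strongly robust if for any $\vec a\in P$, $\vec b\in\vec U$ such that $\vec a\vee\vec b$ and $\vec a\vee\overleftarrow b$ both have order at most $|\vec a|$, one of them lies in $P$. A separation $s$ distinguishes profiles $P_1,P_2$ if it has an orientation with $\vec s\in P_1,\overleftarrow s\in P_2$ (they are distinguishable if such $s$ exists); it does so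 efficiently if no $r\in U$ with $|r|<|s|$ distinguishes them. -}

module Defs where

open import Level using (0ℓ)
open import Data.Nat as ℕ using (ℕ)
open import Data.Bool using (Bool; true; false)
open import Data.List using (List)
open import Data.List.Membership.Propositional using (_∈_)
open import Data.Product using (Σ; ∃; _×_; _,_)
open import Data.Sum using (_⊎_)
open import Relation.Nullary using (¬_)
open import Relation.Binary using (IsPartialOrder; Decidable)
open import Relation.Binary.PropositionalEquality using (_≡_)

-- A distributive submodular universe of (oriented) separations.
-- Carrier = the set of oriented separations  a⃗ ; _* = the involution;
-- the unoriented separation  a  is the pair {a⃗, a⃗ *}.
record DSUniverse : Set₁ where
  infix 4 _≤_
  infixl 6 _∨_
  infixl 7 _∧_
  field
    Carrier  : Set
    _≤_      : Carrier → Carrier → Set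
    _*       : Carrier → Carrier
    _∨_      : Carrier → Carrier → Carrier
    _∧_      : Carrier → Carrier → Carrier
    ∣_∣      : Carrier → ℕ
    elems    : List Carrier
    complete : ∀ a → a ∈ elems
    _≟_      : Decidable {A = Carrier} _≡_
    _≤?_     : Decidable _≤_
    isPartialOrder : IsPartialOrder _≡_ _≤_
    *-invol  : ∀ a → (a *) * ≡ a
    *-rev    : ∀ {a b} → a ≤ b → b * ≤ a *
    ∨-upperˡ : ∀ a b → a ≤ a ∨ b
    ∨-upperʳ : ∀ a b → b ≤ a ∨ b
    ∨-least  : ∀ {a b c} → a ≤ c → b ≤ c → a ∨ b ≤ c
    ∧-lowerˡ : ∀ a b → a ∧ b ≤ a
    ∧-lowerʳ : ∀ a b → a ∧ b ≤ b
    ∧-greatest : ∀ {a b c} → c ≤ a → c ≤ b → c ≤ a ∧ b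
    distrib  : ∀ a b c → a ∨ (b ∧ c) ≡ (a ∨ b) ∧ (a ∨ c)
    ∣*∣      : ∀ a → ∣ a * ∣ ≡ ∣ a ∣
    submod   : ∀ a b → ∣ a ∨ b ∣ ℕ.+ ∣ a ∧ b ∣ ℕ.≤ ∣ a ∣ ℕ.+ ∣ b ∣

module _ (U : DSUniverse) where
  open DSUniverse U

  OSet : Set
  OSet = Carrier → Bool

  _∈ₒ_ : Carrier → OSet → Set
  a ∈ₒ P = P a ≡ true

  record IsKProfile (k : ℕ) (P : OSet) : Set where
    field
      ⊆Sk        : ∀ a → a ∈ₒ P → ∣ a ∣ ℕ.< k
      orients    : ∀ a → ∣ a ∣ ℕ.< k → a ∈ₒ P ⊎ (a *) ∈ₒ P
      unique     : ∀ a → a ∈ₒ P → (a *) ∈ₒ P → a ≡ a *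
      consistent : ∀ a b → a ∈ₒ P → b ∈ₒ P → ¬ (b ≡ a) → ¬ (b ≡ a *) → ¬ (a * ≤ b)
      profile    : ∀ a b → a ∈ₒ P → b ∈ₒ P → ¬ ((a * ∧ b *) ∈ₒ P)

  IsProfile : OSet → Set
  IsProfile P = ∃ λ k → IsKProfile k P

  StronglyRobust : OSet → Set
  StronglyRobust P = ∀ a b → a ∈ₒ P →
    ∣ a ∨ b ∣ ℕ.≤ ∣ a ∣ → ∣ a ∨ (b *) ∣ ℕ.≤ ∣ a ∣ →
    (a ∨ b) ∈ₒ P ⊎ (a ∨ (b *)) ∈ₒ P

  -- the separation s = {a, a*} distinguishes P₁ and P₂ (via the orientation a ∈ P₁, a* ∈ P₂);
  -- quantifying over a covers both orientations of s
  DistinguishedBy : Carrier → OSet → OSet → Set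
  DistinguishedBy a P₁ P₂ = a ∈ₒ P₁ × (a *) ∈ₒ P₂

  Distinguishable : OSet → OSet → Set
  Distinguishable P₁ P₂ = ∃ λ a → DistinguishedBy a P₁ P₂

  EfficientlyDistinguishedBy : Carrier → OSet → OSet → Set
  EfficientlyDistinguishedBy a P₁ P₂ =
    DistinguishedBy a P₁ P₂ × (∀ r → ∣ r ∣ ℕ.< ∣ a ∣ → ¬ DistinguishedBy r P₁ P₂)

  Nested : Carrier → Carrier → Set
  Nested a b = a ≤ b ⊎ a ≤ b * ⊎ a * ≤ b ⊎ a * ≤ b *

  -- a set N of (unoriented) separations, given by a predicate on oriented
  -- separations; the separation {a, a*} belongs to N iff N a or N (a*)
  SepSet : Set₁
  SepSet = Carrier → Set

  _∈ₛ_ : Carrier → SepSet → Set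
  a ∈ₛ N = N a ⊎ N (a *)

  IsNestedSet : SepSet → Set
  IsNestedSet N = ∀ a b → a ∈ₛ N → b ∈ₛ N → Nested a b

  NEffDist : SepSet → OSet → OSet → Set
  NEffDist N P₁ P₂ = ∃ λ a → a ∈ₛ N × EfficientlyDistinguishedBy a P₁ P₂

-- For each Q pick a distinguisher of P and Q that is minimal for the lexicographic
-- order "smaller order, then below in ≤": it is efficient, and ≤-minimal among the
-- efficient ones. Two such, a for Q and b for R with ∣a∣ ≤ ∣b∣, cannot cross.
-- Efficiency of b forces ∣a ∨ b∣ ≥ ∣b∣, so ∣a ∧ b∣ ≤ ∣a∣ by submodularity.
-- If also ∣a ∧ b*∣ ≤ ∣a∣, strong robustness of Q at a* puts (a ∧ b)* or (a ∧ b*)* into Q,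
-- and minimality of a gives a ≤ b or a ≤ b*. Otherwise ∣a ∨ b*∣ < ∣b∣, and strong
-- robustness of R at b* yields either a distinguisher b ∧ a* of P and R of order below ∣b∣
-- or, by minimality of b, b ≤ a.

module Submission where

open import Defs hiding (_∈ₒ_)
import Defs
open import Level using (0ℓ)
open import Data.Bool using (true)
import Data.Bool as Bool
open import Data.Empty using (⊥)
open import Data.List using (List; []; _∷_; length; filter)
open import Data.List.Membership.Propositional using (_∈_; lose)
open import Data.List.Relation.Unary.Any using (here; there; any?; satisfied)
open import Data.Nat as ℕ using (ℕ; s≤s)
import Data.Nat.Properties as ℕ
open import Data.Nat.Induction using () renaming (<-wellFounded to <ℕ-wellFounded)
open import Data.Product using (Σ; ∃; _×_; _,_; proj₂)
open import Data.Product.Relation.Binary.Lex.Strict using (×-Lex; ×-wellFounded; ×-decidable)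
open import Data.Sum using (_⊎_; inj₁; inj₂; [_,_]′)
import Data.Sum as Sum
open import Function using (_∘_; _on_)
open import Induction.WellFounded using (WellFounded; Acc; acc; module Subrelation)
open import Relation.Nullary using (¬_; Dec; yes; no; contradiction)
open import Relation.Nullary.Decidable using (_×-dec_; _⊎-dec_)
open import Relation.Unary using (Pred)
open import Relation.Binary using (Rel; Decidable; IsPartialOrder)
import Relation.Binary.Construct.On as On
import Relation.Binary.Construct.NonStrictToStrict as NonStrictToStrict
open import Relation.Binary.PropositionalEquality
  using (_≡_; _≢_; refl; sym; trans; cong; subst; subst₂)

module _ {A : Set} {_≺_ : Rel A 0ℓ} (≺-wellFounded : WellFounded _≺_) (_≺?_ : Decidable _≺_)
         {xs : List A} (complete : ∀ x → x ∈ xs) where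

  ∃-minimal : {P : Pred A 0ℓ} → (∀ x → Dec (P x)) → ∀ {x} → P x →
              ∃ λ a → P a × (∀ {s} → P s → ¬ s ≺ a)
  ∃-minimal {P} P? {x} = go (≺-wellFounded x)
    where
    go : ∀ {x} → Acc _≺_ x → P x → ∃ λ a → P a × (∀ {s} → P s → ¬ s ≺ a)
    go {x} (acc rec) px with any? (λ s → P? s ×-dec (s ≺? x)) xs
    ... | yes below = let (s , ps , s≺x) = satisfied below in go (rec s≺x) ps
    ... | no none = x , px , λ {s} ps s≺x → none (lose (complete s) (ps , s≺x))

module _ {A : Set} {_≤_ : Rel A 0ℓ} (isPartialOrder : IsPartialOrder _≡_ _≤_)
         (_≤?_ : Decidable _≤_) where

  open NonStrictToStrict _≡_ _≤_ using (_<_)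
  private module PO = IsPartialOrder isPartialOrder

  countBelow : A → List A → ℕ
  countBelow r xs = length (filter (_≤? r) xs)

  countBelow-mono : ∀ {x y} xs → x ≤ y → countBelow x xs ℕ.≤ countBelow y xs
  countBelow-mono [] x≤y = ℕ.z≤n
  countBelow-mono {x} {y} (z ∷ xs) x≤y with z ≤? x | z ≤? y
  ... | yes _   | yes _   = s≤s (countBelow-mono xs x≤y)
  ... | yes z≤x | no z≰y  = contradiction (PO.trans z≤x x≤y) z≰y
  ... | no _    | yes _   = ℕ.m≤n⇒m≤1+n (countBelow-mono xs x≤y)
  ... | no _    | no _    = countBelow-mono xs x≤y

  countBelow-strict : ∀ {x y xs} → x < y → y ∈ xs → countBelow x xs ℕ.< countBelow y xs
  countBelow-strict {x} {y} {z ∷ xs} (x≤y , x≢y) y∈ with z ≤? x | z ≤? y | y∈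
  ... | yes z≤x | no z≰y  | _         = contradiction (PO.trans z≤x x≤y) z≰y
  ... | yes z≤x | yes _   | here refl = contradiction (PO.antisym x≤y z≤x) x≢y
  ... | yes _   | yes _   | there y∈′ = s≤s (countBelow-strict (x≤y , x≢y) y∈′)
  ... | no _    | yes _   | here refl = s≤s (countBelow-mono xs x≤y)
  ... | no _    | yes _   | there y∈′ = ℕ.m≤n⇒m≤1+n (countBelow-strict (x≤y , x≢y) y∈′)
  ... | no _    | no z≰y  | here refl = contradiction PO.refl z≰y
  ... | no _    | no _    | there y∈′ = countBelow-strict (x≤y , x≢y) y∈′

  finite⇒<-wellFounded : (xs : List A) → (∀ x → x ∈ xs) → WellFounded _<_
  finite⇒<-wellFounded xs complete =
    Subrelation.wellFounded (λ x<y → countBelow-strict x<y (complete _))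
      (On.wellFounded (λ r → countBelow r xs) <ℕ-wellFounded)

module _ (U : DSUniverse) where
  open DSUniverse U
  private module PO = IsPartialOrder isPartialOrder

  infix 4 _∈ₒ_
  _∈ₒ_ : Carrier → OSet U → Set
  _∈ₒ_ = Defs._∈ₒ_ U

  *-injective : ∀ {x y} → x * ≡ y * → x ≡ y
  *-injective {x} {y} e = trans (sym (*-invol x)) (trans (cong _* e) (*-invol y))

  *-antitoneˡ : ∀ {x y} → x * ≤ y → y * ≤ x
  *-antitoneˡ {x} {y} p = subst (y * ≤_) (*-invol x) (*-rev p)

  *-antitoneʳ : ∀ {x y} → x ≤ y * → y ≤ x *
  *-antitoneʳ {x} {y} p = subst (_≤ x *) (*-invol y) (*-rev p)

  *-reflect : ∀ {x y} → x * ≤ y * → y ≤ x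
  *-reflect {x} {y} p = subst₂ _≤_ (*-invol y) (*-invol x) (*-rev p)

  ∨-comm : ∀ x y → x ∨ y ≡ y ∨ x
  ∨-comm x y = PO.antisym (∨-least (∨-upperʳ y x) (∨-upperˡ y x)) (∨-least (∨-upperʳ x y) (∨-upperˡ x y))

  ∧-comm : ∀ x y → x ∧ y ≡ y ∧ x
  ∧-comm x y = PO.antisym (∧-greatest (∧-lowerʳ x y) (∧-lowerˡ x y)) (∧-greatest (∧-lowerʳ y x) (∧-lowerˡ y x))

  ∧-idem : ∀ x → x ∧ x ≡ x
  ∧-idem x = PO.antisym (∧-lowerˡ x x) (∧-greatest PO.refl PO.refl)

  *-∨ : ∀ x y → (x ∨ y) * ≡ x * ∧ y *
  *-∨ x y = PO.antisym (∧-greatest (*-rev (∨-upperˡ x y)) (*-rev (∨-upperʳ x y)))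
    (*-antitoneʳ (∨-least (*-antitoneʳ (∧-lowerˡ (x *) (y *))) (*-antitoneʳ (∧-lowerʳ (x *) (y *)))))

  *-∧ : ∀ x y → (x ∧ y) * ≡ x * ∨ y *
  *-∧ x y = PO.antisym
    (*-antitoneˡ (∧-greatest (*-antitoneˡ (∨-upperˡ (x *) (y *))) (*-antitoneˡ (∨-upperʳ (x *) (y *)))))
    (∨-least (*-rev (∧-lowerˡ x y)) (*-rev (∧-lowerʳ x y)))

  *-∧-* : ∀ x y → (x ∧ y *) * ≡ x * ∨ y
  *-∧-* x y = trans (*-∧ x (y *)) (cong (x * ∨_) (*-invol y))

  nested? : ∀ a b → Dec (Nested U a b)
  nested? a b = (a ≤? b) ⊎-dec ((a ≤? (b *)) ⊎-dec (((a *) ≤? b) ⊎-dec ((a *) ≤? (b *))))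

  nested-sym : ∀ {a b} → Nested U a b → Nested U b a
  nested-sym (inj₁ a≤b)                = inj₂ (inj₂ (inj₂ (*-rev a≤b)))
  nested-sym (inj₂ (inj₁ a≤b*))        = inj₂ (inj₁ (*-antitoneʳ a≤b*))
  nested-sym (inj₂ (inj₂ (inj₁ a*≤b))) = inj₂ (inj₂ (inj₁ (*-antitoneˡ a*≤b)))
  nested-sym (inj₂ (inj₂ (inj₂ a*≤b*))) = inj₁ (*-reflect a*≤b*)

  nested-*ˡ : ∀ {a b} → Nested U (a *) b → Nested U a b
  nested-*ˡ {a} {b} (inj₁ a*≤b)                 = inj₂ (inj₂ (inj₁ a*≤b))
  nested-*ˡ {a} {b} (inj₂ (inj₁ a*≤b*))         = inj₂ (inj₂ (inj₂ a*≤b*))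
  nested-*ˡ {a} {b} (inj₂ (inj₂ (inj₁ a**≤b)))  = inj₁ (subst (_≤ b) (*-invol a) a**≤b)
  nested-*ˡ {a} {b} (inj₂ (inj₂ (inj₂ a**≤b*))) = inj₂ (inj₁ (subst (_≤ b *) (*-invol a) a**≤b*))

  nested-*ʳ : ∀ {a b} → Nested U a (b *) → Nested U a b
  nested-*ʳ = nested-sym ∘ nested-*ˡ ∘ nested-sym

  isNestedSet : (N : SepSet U) → (∀ a b → N a → N b → Nested U a b) → IsNestedSet U N
  isNestedSet N nested a b (inj₁ a∈N)  (inj₁ b∈N)  = nested a b a∈N b∈N
  isNestedSet N nested a b (inj₁ a∈N)  (inj₂ b*∈N) = nested-*ʳ (nested a (b *) a∈N b*∈N)
  isNestedSet N nested a b (inj₂ a*∈N) (inj₁ b∈N)  = nested-*ˡ (nested (a *) b a*∈N b∈N)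
  isNestedSet N nested a b (inj₂ a*∈N) (inj₂ b*∈N) = nested-*ˡ (nested-*ʳ (nested (a *) (b *) a*∈N b*∈N))

  *≡⇒∣∣≡ : ∀ {x y} → x * ≡ y → ∣ y ∣ ≡ ∣ x ∣
  *≡⇒∣∣≡ {x} refl = ∣*∣ x

  ∧-order-bound : ∀ a b → ∣ b ∣ ℕ.≤ ∣ a ∨ b ∣ → ∣ a ∧ b ∣ ℕ.≤ ∣ a ∣
  ∧-order-bound a b b≤a∨b = ℕ.+-cancelʳ-≤ (∣ a ∨ b ∣) (∣ a ∧ b ∣) (∣ a ∣) (begin
    ∣ a ∧ b ∣ ℕ.+ ∣ a ∨ b ∣  ≡⟨ ℕ.+-comm (∣ a ∧ b ∣) (∣ a ∨ b ∣) ⟩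
    ∣ a ∨ b ∣ ℕ.+ ∣ a ∧ b ∣  ≤⟨ submod a b ⟩
    ∣ a ∣ ℕ.+ ∣ b ∣          ≤⟨ ℕ.+-monoʳ-≤ (∣ a ∣) b≤a∨b ⟩
    ∣ a ∣ ℕ.+ ∣ a ∨ b ∣      ∎)
    where open ℕ.≤-Reasoning

  ∨-order-bound : ∀ a b → ∣ a ∣ ℕ.< ∣ a ∧ b ∣ → ∣ a ∨ b ∣ ℕ.< ∣ b ∣
  ∨-order-bound a b a<a∧b = ℕ.≰⇒> λ b≤a∨b → ℕ.<⇒≱ a<a∧b (∧-order-bound a b b≤a∨b)

  module KProfile {k : ℕ} {P : OSet U} (isKProfile : IsKProfile U k P) where
    open IsKProfile isKProfile

    ∈⇒*∉ : ∀ {x} → x ∈ₒ P → ¬ (x * ∈ₒ P)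
    ∈⇒*∉ {x} x∈P x*∈P = profile x x x∈P x∈P (subst (_∈ₒ P) (sym (∧-idem (x *))) x*∈P)

    ∈-downward : ∀ {c d} → c ∈ₒ P → d ≤ c → ∣ d ∣ ℕ.< k → d ≢ c * → d ∈ₒ P
    ∈-downward {c} {d} c∈P d≤c d<k d≢c* with orients d d<k
    ... | inj₁ d∈P = d∈P
    ... | inj₂ d*∈P with d ≟ c
    ...   | yes refl = c∈P
    ...   | no d≢c = contradiction (*-rev d≤c)
                       (consistent c (d *) c∈P d*∈P
                         (λ d*≡c → d≢c* (trans (sym (*-invol d)) (cong _* d*≡c)))
                         (d≢c ∘ *-injective))

    ∨-∈ : ∀ {x y} → x ∈ₒ P → y ∈ₒ P → ∣ x ∨ y ∣ ℕ.< k → x ∨ y ∈ₒ P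
    ∨-∈ {x} {y} x∈P y∈P x∨y<k with orients (x ∨ y) x∨y<k
    ... | inj₁ x∨y∈P = x∨y∈P
    ... | inj₂ [x∨y]*∈P = contradiction (subst (_∈ₒ P) (*-∨ x y) [x∨y]*∈P) (profile x y x∈P y∈P)

    ∧-∈ : ∀ {c e} → c ∈ₒ P → ∣ c ∧ e ∣ ℕ.≤ ∣ c ∣ → ¬ (c * ≤ e) → c ∧ e ∈ₒ P
    ∧-∈ {c} {e} c∈P c∧e≤c c*≰e =
      ∈-downward c∈P (∧-lowerˡ c e) (ℕ.≤-<-trans c∧e≤c (⊆Sk c c∈P))
        (λ c∧e≡c* → c*≰e (subst (_≤ e) c∧e≡c* (∧-lowerʳ c e)))

  efficient⇒∨-order-≥ : ∀ {kP kR P R a b} → IsKProfile U kP P → IsKProfile U kR R →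
                        a ∈ₒ P → EfficientlyDistinguishedBy U b P R → ∣ b ∣ ℕ.≤ ∣ a ∨ b ∣
  efficient⇒∨-order-≥ {kP} {kR} {P} {R} {a} {b} pP pR a∈P ((b∈P , b*∈R) , efficient) =
    ℕ.≮⇒≥ λ a∨b<b → efficient (a ∨ b) a∨b<b (a∨b∈P a∨b<b , [a∨b]*∈R a∨b<b)
    where
    module P = KProfile pP
    module R = KProfile pR

    a∨b∈P : ∣ a ∨ b ∣ ℕ.< ∣ b ∣ → a ∨ b ∈ₒ P
    a∨b∈P a∨b<b = P.∨-∈ a∈P b∈P (ℕ.<-trans a∨b<b (IsKProfile.⊆Sk pP b b∈P))

    [a∨b]*∈R : ∣ a ∨ b ∣ ℕ.< ∣ b ∣ → (a ∨ b) * ∈ₒ R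
    [a∨b]*∈R a∨b<b = R.∈-downward b*∈R (*-rev (∨-upperʳ a b)) [a∨b]*<kR
      (λ [a∨b]*≡b** → P.∈⇒*∉ b∈P (subst (_∈ₒ P) (*-injective [a∨b]*≡b**) (a∨b∈P a∨b<b)))
      where
      [a∨b]*<kR : ∣ (a ∨ b) * ∣ ℕ.< kR
      [a∨b]*<kR = begin-strict
        ∣ (a ∨ b) * ∣ ≡⟨ ∣*∣ (a ∨ b) ⟩
        ∣ a ∨ b ∣     <⟨ a∨b<b ⟩
        ∣ b ∣         ≡⟨ ∣*∣ b ⟨
        ∣ b * ∣       <⟨ IsKProfile.⊆Sk pR (b *) b*∈R ⟩
        kR            ∎
        where open ℕ.≤-Reasoning

  stronglyRobust-meets : ∀ {Q a b} → StronglyRobust U Q → a * ∈ₒ Q →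
                         ∣ a ∧ b * ∣ ℕ.≤ ∣ a ∣ → ∣ a ∧ b ∣ ℕ.≤ ∣ a ∣ →
                         (a ∧ b *) * ∈ₒ Q ⊎ (a ∧ b) * ∈ₒ Q
  stronglyRobust-meets {Q} {a} {b} robust a*∈Q a∧b*≤a a∧b≤a =
    Sum.map (subst (_∈ₒ Q) (sym (*-∧-* a b))) (subst (_∈ₒ Q) (sym (*-∧ a b)))
      (robust (a *) b a*∈Q (bound (*-∧-* a b) a∧b*≤a) (bound (*-∧ a b) a∧b≤a))
    where
    bound : ∀ {x y} → x * ≡ y → ∣ x ∣ ℕ.≤ ∣ a ∣ → ∣ y ∣ ℕ.≤ ∣ a * ∣
    bound x*≡y = subst₂ ℕ._≤_ (sym (*≡⇒∣∣≡ x*≡y)) (sym (∣*∣ a))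

  open NonStrictToStrict _≡_ _≤_ using (_<_)

  _⊏_ : Rel Carrier 0ℓ
  _⊏_ = ×-Lex _≡_ ℕ._<_ _<_ on (λ r → ∣ r ∣ , r)

  ⊏-wellFounded : WellFounded _⊏_
  ⊏-wellFounded = On.wellFounded (λ r → ∣ r ∣ , r)
    (×-wellFounded <ℕ-wellFounded (finite⇒<-wellFounded isPartialOrder _≤?_ elems complete))

  _⊏?_ : Decidable _⊏_
  _⊏?_ = On.decidable (λ r → ∣ r ∣ , r) _
    (×-decidable ℕ._≟_ ℕ._<?_ (NonStrictToStrict.<-decidable _≡_ _≤_ _≟_ _≤?_))

  record Tight (P Q : OSet U) (a : Carrier) : Set where
    constructor tight
    field
      distinguishes : DistinguishedBy U a P Q
      minimal       : ∀ {s} → DistinguishedBy U s P Q → ¬ s ⊏ a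

  ∃-tight : ∀ {P Q} → Distinguishable U P Q → ∃ (Tight P Q)
  ∃-tight {P} {Q} (_ , distinguished) =
    let (a , a-distinguishes , minimal) =
          ∃-minimal ⊏-wellFounded _⊏?_ complete
            (λ s → (P s Bool.≟ true) ×-dec (Q (s *) Bool.≟ true)) distinguished
    in a , tight a-distinguishes minimal

  tight⇒efficient : ∀ {P Q a} → Tight P Q a → EfficientlyDistinguishedBy U a P Q
  tight⇒efficient (tight distinguished minimal) =
    distinguished , λ s s<a s-distinguishes → minimal s-distinguishes (inj₁ s<a)

  tight-∧⇒≤ : ∀ {P Q a e} → Tight P Q a → a ∧ e ∈ₒ P → (a ∧ e) * ∈ₒ Q →
              ∣ a ∧ e ∣ ℕ.≤ ∣ a ∣ → a ≤ e
  tight-∧⇒≤ {a = a} {e} (tight _ minimal) a∧e∈P [a∧e]*∈Q a∧e≤a with (a ∧ e) ≟ a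
  ... | yes a∧e≡a = subst (_≤ e) a∧e≡a (∧-lowerʳ a e)
  ... | no a∧e≢a = contradiction a∧e⊏a (minimal (a∧e∈P , [a∧e]*∈Q))
    where
    a∧e⊏a : (a ∧ e) ⊏ a
    a∧e⊏a = Sum.map₂ (λ same-order → same-order , ∧-lowerˡ a e , a∧e≢a) (ℕ.m≤n⇒m<n∨m≡n a∧e≤a)

  crossing-small-meet-⊥ : ∀ {kP P Q a b} → IsKProfile U kP P → StronglyRobust U Q → Tight P Q a →
                          ∣ a ∧ b ∣ ℕ.≤ ∣ a ∣ → ∣ a ∧ b * ∣ ℕ.≤ ∣ a ∣ → ¬ Nested U a b → ⊥
  crossing-small-meet-⊥ {Q = Q} pP robustQ tightQ@(tight (a∈P , a*∈Q) _) a∧b≤a a∧b*≤a crossing =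
    [ (λ [a∧b*]*∈Q → crossing (inj₂ (inj₁
        (tight-∧⇒≤ tightQ (P.∧-∈ a∈P a∧b*≤a (crossing ∘ inj₂ ∘ inj₂ ∘ inj₂)) [a∧b*]*∈Q a∧b*≤a))))
    , (λ [a∧b]*∈Q → crossing (inj₁
        (tight-∧⇒≤ tightQ (P.∧-∈ a∈P a∧b≤a (crossing ∘ inj₂ ∘ inj₂ ∘ inj₁)) [a∧b]*∈Q a∧b≤a)))
    ]′ (stronglyRobust-meets {Q} robustQ a*∈Q a∧b*≤a a∧b≤a)
    where module P = KProfile pP

  crossing-large-meet-⊥ : ∀ {kP P R a b} → IsKProfile U kP P → StronglyRobust U R → Tight P R b →
                          ∣ b ∧ a ∣ ℕ.≤ ∣ b ∣ → ∣ a ∣ ℕ.< ∣ a ∧ b * ∣ → ¬ Nested U a b → ⊥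
  crossing-large-meet-⊥ {R = R} {a} {b} pP robustR tightR@(tight (b∈P , b*∈R) _) b∧a≤b a<a∧b* crossing =
    [ (λ [b∧a*]*∈R → proj₂ (tight⇒efficient tightR) (b ∧ a *) b∧a*<b
        (P.∧-∈ b∈P (ℕ.<⇒≤ b∧a*<b) (crossing ∘ inj₁ ∘ *-reflect) , [b∧a*]*∈R))
    , (λ [b∧a]*∈R → crossing (inj₂ (inj₂ (inj₂ (*-rev
        (tight-∧⇒≤ tightR (P.∧-∈ b∈P b∧a≤b (crossing ∘ inj₂ ∘ inj₂ ∘ inj₁ ∘ *-antitoneˡ)) [b∧a]*∈R b∧a≤b))))))
    ]′ (stronglyRobust-meets {R} robustR b*∈R (ℕ.<⇒≤ b∧a*<b) b∧a≤b)
    where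
    module P = KProfile pP

    b∧a*<b : ∣ b ∧ a * ∣ ℕ.< ∣ b ∣
    b∧a*<b = begin-strict
      ∣ b ∧ a * ∣ ≡⟨ *≡⇒∣∣≡ (*-∧-* b a) ⟨
      ∣ b * ∨ a ∣ ≡⟨ cong ∣_∣ (∨-comm (b *) a) ⟩
      ∣ a ∨ b * ∣ <⟨ ∨-order-bound a (b *) a<a∧b* ⟩
      ∣ b * ∣     ≡⟨ ∣*∣ b ⟩
      ∣ b ∣       ∎
      where open ℕ.≤-Reasoning

  tight-nested-≤ : ∀ {kP kR P Q R a b} → IsKProfile U kP P → IsKProfile U kR R →
                   StronglyRobust U Q → StronglyRobust U R → Tight P Q a → Tight P R b →
                   ∣ a ∣ ℕ.≤ ∣ b ∣ → ¬ Nested U a b → ⊥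
  tight-nested-≤ {a = a} {b} pP pR robustQ robustR tightQ@(tight (a∈P , _) _) tightR a≤b =
    [ crossing-small-meet-⊥ pP robustQ tightQ a∧b≤a
    , crossing-large-meet-⊥ pP robustR tightR b∧a≤b
    ]′ (ℕ.≤-<-connex ∣ a ∧ b * ∣ ∣ a ∣)
    where
    a∧b≤a : ∣ a ∧ b ∣ ℕ.≤ ∣ a ∣
    a∧b≤a = ∧-order-bound a b (efficient⇒∨-order-≥ pP pR a∈P (tight⇒efficient tightR))

    b∧a≤b : ∣ b ∧ a ∣ ℕ.≤ ∣ b ∣
    b∧a≤b = subst (ℕ._≤ ∣ b ∣) (cong ∣_∣ (∧-comm a b)) (ℕ.≤-trans a∧b≤a a≤b)

  tight-nested : ∀ {kP kQ kR P Q R a b} → IsKProfile U kP P →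
                 IsKProfile U kQ Q → StronglyRobust U Q → IsKProfile U kR R → StronglyRobust U R →
                 Tight P Q a → Tight P R b → Nested U a b
  tight-nested {a = a} {b} pP pQ robustQ pR robustR tightQ tightR with nested? a b
  ... | yes nested = nested
  ... | no crossing with ℕ.≤-total ∣ a ∣ ∣ b ∣
  ...   | inj₁ a≤b = contradiction crossing (tight-nested-≤ pP pR robustQ robustR tightQ tightR a≤b)
  ...   | inj₂ b≤a = contradiction (crossing ∘ nested-sym)
                       (tight-nested-≤ pP pQ robustR robustQ tightR tightQ b≤a)

mainTheorem15 : (U : DSUniverse) (P : OSet U) → IsProfile U P →
    (𝒫′ : List (OSet U)) →
    (∀ Q → Q ∈ 𝒫′ → IsProfile U Q × StronglyRobust U Q × Distinguishable U P Q) →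
    Σ (SepSet U) λ N → IsNestedSet U N × (∀ Q → Q ∈ 𝒫′ → NEffDist U N P Q)
mainTheorem15 U P (_ , pP) 𝒫′ 𝒫′-robust = N , isNestedSet U N N-nested , N-efficient
  where
  N : SepSet U
  N a = ∃ λ Q → Q ∈ 𝒫′ × Tight U P Q a

  N-nested : ∀ a b → N a → N b → Nested U a b
  N-nested a b (Q , Q∈𝒫′ , tightQ) (R , R∈𝒫′ , tightR) =
    let ((_ , pQ) , robustQ , _) = 𝒫′-robust Q Q∈𝒫′
        ((_ , pR) , robustR , _) = 𝒫′-robust R R∈𝒫′
    in tight-nested U pP pQ robustQ pR robustR tightQ tightR

  N-efficient : ∀ Q → Q ∈ 𝒫′ → NEffDist U N P Q
  N-efficient Q Q∈𝒫′ =
    let (a , tightQ) = ∃-tight U (proj₂ (proj₂ (𝒫′-robust Q Q∈𝒫′)))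
    in a , inj₁ (Q , Q∈𝒫′ , tightQ) , tight⇒efficient U tightQ
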